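{- Let $T$ be an order tree and $G$ a $T$-graph of finite adhesion. For each end $\varepsilon$ of $G$ let $\sigma(\varepsilon)=\{t\in T : \varepsilon\in\partial\lfloor t\rfloor\setminus\partial(T\setminus\lfloor t\rfloor)\}$. Then $\sigma$ is a bijection from $\Omega(G)$ onto the set $\mathcal R(T)$ of high-rays of $T$.
   Context: Ends: a ray is a one-way infinite path; two rays are equivalent if for every finite $X\subset V(G)$ they have tails in the same component of $G-X$; the classes are the ends, forming $\Omega(G)$. For finite $X$ and end $\varepsilon$, $C(X,\varepsilon)$ is the component of $G-X$ containing tails of all rays of $\varepsilon$. For a vertex set $M$, $\partial M$ is the set of ends $\varepsilon$ such that $C(X,\varepsilon)$ meets $M$ for every finite $X$. An order tree is a poset $(T,\le)$ with a unique minimal element in which every $\lceil t\rceil=\{t'\le t\}$ is well-ordered; $\mathring{\lceil t\rceil}=\lceil t\rceil\setminus\{t\}$, $\lfloor t\rfloor=\{t'\ge t\}$. The height of $t$ is the order type of $\mathring{\lceil t\rceil}$; $T^{\le\sigma}$ is the set of points of height at most $\sigma$. A high-ray of $T$ is a down-closed chain of $T$ whose order type has cofinality $\omega$. A graph $G$ is a $T$-graph if $V(G)=T$, endvertices of every edge are comparable in $T$, and for each $t$ the set of neighbours of $t$ below $t$ is cofinal in $\mathring{\lceil t\rceil}$. A $T$-graph has finite adhesion if for every limit ordinal $\sigma$ every component of $G-T^{\le\sigma}$ has finite neighbourhood. -}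

module Defs where

open import Level using (0ℓ)
open import Data.Nat using (ℕ; suc) renaming (_≤_ to _≤ℕ_)
open import Data.Product using (Σ; ∃; ∃-syntax; _×_; _,_; proj₁)
open import Data.Sum using (_⊎_)
open import Data.List using (List)
open import Data.List.Membership.Propositional using (_∈_)
open import Relation.Nullary using (¬_)
open import Relation.Binary.PropositionalEquality using (_≡_; _≢_)
open import Induction.WellFounded using (WellFounded)

record OrderTree : Set₁ where
  field
    V        : Set
    _≼_      : V → V → Set
    ≼-refl   : ∀ {t} → t ≼ t
    ≼-trans  : ∀ {a b c} → a ≼ b → b ≼ c → a ≼ c
    ≼-antisym : ∀ {a b} → a ≼ b → b ≼ a → a ≡ b
    root          : V
    root-minimal  : ∀ {t} → t ≼ root → t ≡ root
    root-unique   : ∀ r → (∀ {t} → t ≼ r → t ≡ r) → r ≡ root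
    -- ⌈ t ⌉ = { t' ≼ t } is well-ordered: a chain in which every
    -- nonempty subset has a least element
    down-total : ∀ {t a b} → a ≼ t → b ≼ t → (a ≼ b) ⊎ (b ≼ a)
    down-least : ∀ t (P : V → Set) → (∃[ a ] (a ≼ t × P a)) →
                 ∃[ m ] (m ≼ t × P m × (∀ a → a ≼ t → P a → m ≼ a))

  _≺_ : V → V → Set
  a ≺ b = (a ≼ b) × (a ≢ b)

  up : V → V → Set
  up t s = t ≼ s

  notUp : V → V → Set
  notUp t s = ¬ (t ≼ s)

-- High-rays: down-closed chains whose order type has cofinality ω,
-- i.e. which admit a strictly increasing cofinal ω-sequence.

module _ (𝕋 : OrderTree) where
  open OrderTree 𝕋

  IsHighRay : (V → Set) → Set
  IsHighRay H =
    (∀ a b → H b → a ≼ b → H a) ×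
    (∀ a b → H a → H b → (a ≼ b) ⊎ (b ≼ a)) ×
    (Σ (ℕ → V) λ f → ((∀ (n : ℕ) → H (f n)) ×
             (∀ n → f n ≺ f (suc n)) ×
             (∀ h → H h → ∃[ n ] (h ≼ f n))))

  record TGraph : Set₁ where
    field
      E         : V → V → Set
      E-sym     : ∀ {a b} → E a b → E b a
      E-irrefl  : ∀ {a} → ¬ E a a
      E-comparable : ∀ {a b} → E a b → (a ≼ b) ⊎ (b ≼ a)
      E-cofinal : ∀ t s → s ≺ t → ∃[ u ] (s ≼ u × u ≺ t × E u t)

record LimitOrdinal : Set₁ where
  field
    W       : Set
    _<_     : W → W → Set
    <-irrefl : ∀ {a} → ¬ (a < a)
    <-trans : ∀ {a b c} → a < b → b < c → a < c
    <-tri   : ∀ a b → (a < b) ⊎ (a ≡ b) ⊎ (b < a)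
    <-wf    : WellFounded _<_
    nonzero : W
    no-max  : ∀ w → ∃[ w' ] (w < w')

module _ {𝕋 : OrderTree} (G : TGraph 𝕋) where
  open OrderTree 𝕋
  open TGraph G

  data PathAvoid (S : V → Set) : V → V → Set where
    here : ∀ {a} → ¬ S a → PathAvoid S a a
    step : ∀ {a b c} → ¬ S a → E a b → PathAvoid S b c → PathAvoid S a c

  -- finite vertex sets are given by lists
  InList : List V → V → Set
  InList X v = v ∈ X

  record Ray : Set where
    field
      r    : ℕ → V
      inj  : ∀ m n → r m ≡ r n → m ≡ n
      adj  : ∀ n → E (r n) (r (suc n))
  open Ray public

  -- equivalence of rays (ends are the classes)
  EquivRays : Ray → Ray → Set
  EquivRays R₁ R₂ = ∀ (X : List V) →
    ∃[ m ] ∃[ n ] ((∀ i → m ≤ℕ i → ¬ (r R₁ i ∈ X)) ×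
                   (∀ i → n ≤ℕ i → ¬ (r R₂ i ∈ X)) ×
                   PathAvoid (InList X) (r R₁ m) (r R₂ n))

  -- the end of R lies in ∂M : for every finite X, C(X, end of R) meets M
  InBoundary : Ray → (V → Set) → Set
  InBoundary R M = ∀ (X : List V) →
    ∃[ k ] ((∀ i → k ≤ℕ i → ¬ (r R i ∈ X)) ×
            ∃[ v ] (M v × PathAvoid (InList X) (r R k) v))

  sigma : Ray → V → Set
  sigma R t = InBoundary R (up t) × ¬ InBoundary R (notUp t)

  -- height(t) ≤ σ : the order type of the strict down-set of t embeds
  -- strictly increasingly into σ
  HeightLe : LimitOrdinal → V → Set
  HeightLe σ t = Σ (Σ V (λ s → s ≺ t) → LimitOrdinal.W σ) λ f → (∀ (a b : Σ V (λ s → s ≺ t)) →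
                   proj₁ a ≺ proj₁ b → LimitOrdinal._<_ σ (f a) (f b))

  -- finite adhesion: for every limit ordinal σ, each component of
  -- G - T^{≤σ} (the component of some v ∉ T^{≤σ}) has finite neighbourhood
  FiniteAdhesion : Set₁
  FiniteAdhesion = ∀ (σ : LimitOrdinal) (v : V) → ¬ HeightLe σ v →
    ∃[ L ] (∀ u → HeightLe σ u →
              (∃[ w ] (PathAvoid (HeightLe σ) v w × E w u)) → u ∈ L)

_≐_ : {A : Set} → (A → Set) → (A → Set) → Set
P ≐ Q = ∀ a → (P a → Q a) × (Q a → P a)

-- Let B(R) be the set of points lying below a whole tail of the ray R.  It is
-- a down-closed chain; the infimum of the tail from n is a vertex of R (when R
-- leaves the up-closure of a point it steps below it), and these infima,
-- together with B(R) having no maximum, give a cofinal ω-sequence, so B(R) is a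
-- high-ray.  Finite adhesion shows σ(ε) = B(R): for t ∈ B(R) let [y,t] be the
-- longest finite interval below t; y has no predecessor, so the component of a
-- tail of R above y has only finitely many neighbours below y, and deleting
-- these together with [y,t] traps a tail of R in ⌊t⌋.  Rays with the same B(R)
-- are equivalent, since two comparable vertices are joined by an ascending path
-- (T-graph cofinality) that stays inside the interval between them; and
-- concatenating ascending paths along a cofinal sequence of a given high-ray H
-- yields a ray R with B(R) = H.
module Submission where

open import Defs
open import Level using (0ℓ)
open import Axiom.ExcludedMiddle using (ExcludedMiddle)
open import Axiom.DoubleNegationElimination using (em⇒dne)
open import Data.Bool.Properties using (T-irrelevant)
open import Data.Empty using (⊥-elim)
open import Data.List using (List; []; _∷_; _++_)
open import Data.List.Membership.Propositional using (_∈_; _∉_)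
open import Data.List.Membership.Propositional.Properties using (∈-++⁺ˡ; ∈-++⁺ʳ)
open import Data.List.Relation.Unary.Any using (here; there)
open import Data.Nat using (ℕ; zero; suc; _⊔_; _≤_; _<_; _≤′_; ≤′-refl; ≤′-step; z≤n)
open import Data.Nat.Properties
  using (≤-refl; ≤-trans; ≤-total; <-cmp; <-irrefl; m≤m⊔n; m≤n⊔m; m≤n⇒m≤1+n; m≤n⇒m<n∨m≡n; ≤⇒≤′; ≤′⇒≤)
open import Data.Product using (Σ; ∃-syntax; _×_; _,_; proj₁; proj₂)
open import Data.Sum using (_⊎_; inj₁; inj₂)
open import Data.Unit using (⊤; tt)
open import Function using (_∘_)
open import Induction.WellFounded using (WellFounded; Acc; acc)
open import Relation.Binary.Definitions using (tri<; tri≈; tri>)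
open import Relation.Binary.PropositionalEquality using (_≡_; _≢_; refl; sym; trans; cong; subst)
open import Relation.Nullary using (¬_; Dec; yes; no)
open import Relation.Nullary.Decidable using (True; toWitness; fromWitness)

≐-sym : {A : Set} {P Q : A → Set} → P ≐ Q → Q ≐ P
≐-sym P≐Q a = proj₂ (P≐Q a) , proj₁ (P≐Q a)

≐-trans : {A : Set} {P Q S : A → Set} → P ≐ Q → Q ≐ S → P ≐ S
≐-trans P≐Q Q≐S a = proj₁ (Q≐S a) ∘ proj₁ (P≐Q a) , proj₂ (P≐Q a) ∘ proj₂ (Q≐S a)

AllFrom : ℕ → (ℕ → Set) → Set
AllFrom k P = ∀ i → k ≤ i → P i

Eventually : (ℕ → Set) → Set
Eventually P = ∃[ k ] AllFrom k P

AllFrom-mono : ∀ {P : ℕ → Set} {k l} → k ≤ l → AllFrom k P → AllFrom l P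
AllFrom-mono k≤l all i l≤i = all i (≤-trans k≤l l≤i)

AllFrom-induction : ∀ {P : ℕ → Set} {k} → P k → (∀ i → k ≤ i → P i → P (suc i)) → AllFrom k P
AllFrom-induction {P} {k} base ind i k≤i = go (≤⇒≤′ k≤i)
  where
  go : ∀ {i} → k ≤′ i → P i
  go ≤′-refl          = base
  go (≤′-step k≤′i) = ind _ (≤′⇒≤ k≤′i) (go k≤′i)

module OrderTreeProperties (𝕋 : OrderTree) where
  open OrderTree 𝕋

  ≺-irrefl : ∀ {a} → ¬ (a ≺ a)
  ≺-irrefl (_ , a≢a) = a≢a refl

  ≺-≼-trans : ∀ {a b c} → a ≺ b → b ≼ c → a ≺ c
  ≺-≼-trans (a≼b , a≢b) b≼c = ≼-trans a≼b b≼c , λ { refl → a≢b (≼-antisym a≼b b≼c) }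

  ≼-≺-trans : ∀ {a b c} → a ≼ b → b ≺ c → a ≺ c
  ≼-≺-trans a≼b (b≼c , b≢c) = ≼-trans a≼b b≼c , λ { refl → b≢c (≼-antisym b≼c a≼b) }

  ≺-trans : ∀ {a b c} → a ≺ b → b ≺ c → a ≺ c
  ≺-trans a≺b b≺c = ≺-≼-trans a≺b (proj₁ b≺c)

  ≺⇒⋡ : ∀ {a b} → a ≺ b → ¬ (b ≼ a)
  ≺⇒⋡ (a≼b , a≢b) b≼a = a≢b (≼-antisym a≼b b≼a)

  comparable∧⋡⇒≺ : ∀ {a b} → (a ≼ b) ⊎ (b ≼ a) → ¬ (b ≼ a) → a ≺ b
  comparable∧⋡⇒≺ (inj₁ a≼b) b⋠a = a≼b , λ { refl → b⋠a a≼b }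
  comparable∧⋡⇒≺ (inj₂ b≼a) b⋠a = ⊥-elim (b⋠a b≼a)

  root-≼ : ∀ t → root ≼ t
  root-≼ t with down-least t (λ _ → ⊤) (t , ≼-refl , tt)
  ... | m , m≼t , _ , least = subst (_≼ t) (root-unique m minimal) m≼t
    where
    minimal : ∀ {s} → s ≼ m → s ≡ m
    minimal s≼m = ≼-antisym s≼m (least _ (≼-trans s≼m m≼t) tt)

  increasing-steps⇒strictly-monotone : (g : ℕ → V) → (∀ k → g k ≺ g (suc k)) → ∀ {i j} → i < j → g i ≺ g j
  increasing-steps⇒strictly-monotone g g-step {i} i<j =
    AllFrom-induction (g-step i) (λ k _ gi≺gk → ≺-trans gi≺gk (g-step k)) _ i<j

  increasing-steps⇒monotone : (g : ℕ → V) → (∀ k → g k ≺ g (suc k)) → ∀ {i j} → i ≤ j → g i ≼ g j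
  increasing-steps⇒monotone g g-step i≤j with m≤n⇒m<n∨m≡n i≤j
  ... | inj₁ i<j  = proj₁ (increasing-steps⇒strictly-monotone g g-step i<j)
  ... | inj₂ refl = ≼-refl

  increasing-steps⇒injective : (g : ℕ → V) → (∀ k → g k ≺ g (suc k)) → ∀ i j → g i ≡ g j → i ≡ j
  increasing-steps⇒injective g g-step i j gi≡gj with <-cmp i j
  ... | tri< i<j _ _ = ⊥-elim (proj₂ (increasing-steps⇒strictly-monotone g g-step i<j) gi≡gj)
  ... | tri≈ _ i≡j _ = i≡j
  ... | tri> _ _ j<i = ⊥-elim (proj₂ (increasing-steps⇒strictly-monotone g g-step j<i) (sym gi≡gj))

  IsHighRay-resp-≐ : ∀ {P Q : V → Set} → P ≐ Q → IsHighRay 𝕋 P → IsHighRay 𝕋 Q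
  IsHighRay-resp-≐ {P} {Q} P≐Q (down-closed , chain , f , f∈P , f-strict , f-cofinal) =
    (λ a b b∈Q a≼b → to a (down-closed a b (from b b∈Q) a≼b)) ,
    (λ a b a∈Q b∈Q → chain a b (from a a∈Q) (from b b∈Q)) ,
    f , (λ n → to (f n) (f∈P n)) , f-strict , (λ h h∈Q → f-cofinal h (from h h∈Q))
    where
    to : ∀ a → P a → Q a
    to a = proj₁ (P≐Q a)
    from : ∀ a → Q a → P a
    from a = proj₂ (P≐Q a)

  isHighRay : ∀ {H : V → Set} →
    (∀ a b → H b → a ≼ b → H a) → (∀ a b → H a → H b → (a ≼ b) ⊎ (b ≼ a)) →
    (∀ t → H t → ∃[ t' ] (H t' × t ≺ t')) →
    (m : ℕ → V) → (∀ {i j} → i ≤ j → m i ≼ m j) → (∀ n → H (m n)) →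
    (∀ t → H t → ∃[ n ] (t ≼ m n)) →
    IsHighRay 𝕋 H
  isHighRay {H} down-closed chain no-max m m-mono m∈H m-cofinal =
    down-closed , chain , m ∘ idx , m∈H ∘ idx , strict , cofinal
    where
    above : ∀ n → ∃[ n' ] (m n ≺ m n')
    above n with no-max (m n) (m∈H n)
    ... | t' , t'∈H , mn≺t' with m-cofinal t' t'∈H
    ... | n' , t'≼mn' = n' , ≺-≼-trans mn≺t' t'≼mn'

    idx : ℕ → ℕ
    idx zero    = 0
    idx (suc k) = proj₁ (above (idx k)) ⊔ suc k

    k≤idx : ∀ k → k ≤ idx k
    k≤idx zero    = z≤n
    k≤idx (suc k) = m≤n⊔m _ (suc k)

    strict : ∀ k → m (idx k) ≺ m (idx (suc k))
    strict k = ≺-≼-trans (proj₂ (above (idx k))) (m-mono (m≤m⊔n _ (suc k)))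

    cofinal : ∀ h → H h → ∃[ k ] (h ≼ m (idx k))
    cofinal h h∈H with m-cofinal h h∈H
    ... | n , h≼mn = n , ≼-trans h≼mn (m-mono (k≤idx n))

module TGraphProperties {𝕋 : OrderTree} (G : TGraph 𝕋) where
  open OrderTree 𝕋
  open TGraph G
  open OrderTreeProperties 𝕋

  module _ {S : V → Set} where
    walk-start : ∀ {a b} → PathAvoid G S a b → ¬ S a
    walk-start (here ¬Sa)     = ¬Sa
    walk-start (step ¬Sa _ _) = ¬Sa

    walk-end : ∀ {a b} → PathAvoid G S a b → ¬ S b
    walk-end (here ¬Sb)   = ¬Sb
    walk-end (step _ _ p) = walk-end p

    infixr 5 _++ʷ_
    _++ʷ_ : ∀ {a b c} → PathAvoid G S a b → PathAvoid G S b c → PathAvoid G S a c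
    here _       ++ʷ q = q
    step ¬Sa e p ++ʷ q = step ¬Sa e (p ++ʷ q)

    walk-snoc : ∀ {a b c} → PathAvoid G S a b → E b c → ¬ S c → PathAvoid G S a c
    walk-snoc p e ¬Sc = p ++ʷ step (walk-end p) e (here ¬Sc)

    walk-reverse : ∀ {a b} → PathAvoid G S a b → PathAvoid G S b a
    walk-reverse (here ¬Sa)     = here ¬Sa
    walk-reverse (step ¬Sa e p) = walk-snoc (walk-reverse p) (E-sym e) ¬Sa

  walk-map : ∀ {S S' : V → Set} → (∀ x → ¬ S x → ¬ S' x) → ∀ {a b} → PathAvoid G S a b → PathAvoid G S' a b
  walk-map f (here ¬Sa)     = here (f _ ¬Sa)
  walk-map f (step ¬Sa e p) = step (f _ ¬Sa) e (walk-map f p)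

  module _ (R : Ray G) where
    private
      ρ : ℕ → V
      ρ = r R

    ray-walk : ∀ {S i j} → i ≤ j → AllFrom i (λ k → ¬ S (ρ k)) → PathAvoid G S (ρ i) (ρ j)
    ray-walk {S} {i} i≤j avoid =
      AllFrom-induction (here (avoid i ≤-refl))
        (λ k i≤k p → walk-snoc p (adj R k) (avoid (suc k) (m≤n⇒m≤1+n i≤k))) _ i≤j

    ray-connects : ∀ {S i j} → AllFrom i (λ k → ¬ S (ρ k)) → AllFrom j (λ k → ¬ S (ρ k)) →
                   PathAvoid G S (ρ i) (ρ j)
    ray-connects {i = i} {j} avoidᵢ avoidⱼ with ≤-total i j
    ... | inj₁ i≤j = ray-walk i≤j avoidᵢ
    ... | inj₂ j≤i = walk-reverse (ray-walk j≤i avoidⱼ)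

    step-out-of-up⇒≺ : ∀ {y j} → y ≼ ρ j → ¬ (y ≼ ρ (suc j)) → ρ (suc j) ≺ y
    step-out-of-up⇒≺ {y} {j} y≼ρj y⋠ρj+1 with E-comparable (adj R j)
    ... | inj₁ ρj≼ρj+1 = ⊥-elim (y⋠ρj+1 (≼-trans y≼ρj ρj≼ρj+1))
    ... | inj₂ ρj+1≼ρj = comparable∧⋡⇒≺ (down-total ρj+1≼ρj y≼ρj) y⋠ρj+1

  EquivRays-sym : ∀ R₁ R₂ → EquivRays G R₁ R₂ → EquivRays G R₂ R₁
  EquivRays-sym R₁ R₂ R₁~R₂ X with R₁~R₂ X
  ... | m , n , avoid₁ , avoid₂ , p = n , m , avoid₂ , avoid₁ , walk-reverse p

  InBoundary-resp-EquivRays : ∀ R₁ R₂ M → EquivRays G R₁ R₂ → InBoundary G R₁ M → InBoundary G R₂ M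
  InBoundary-resp-EquivRays R₁ R₂ M R₁~R₂ ∂M X with R₁~R₂ X | ∂M X
  ... | m , n , avoid₁ , avoid₂ , p | k , avoid , v , v∈M , q =
    n , avoid₂ , v , v∈M , walk-reverse p ++ʷ ray-connects R₁ avoid₁ avoid ++ʷ q

  sigma-resp-EquivRays : ∀ R₁ R₂ → EquivRays G R₁ R₂ → sigma G R₁ ≐ sigma G R₂
  sigma-resp-EquivRays R₁ R₂ R₁~R₂ t = transfer R₁ R₂ R₁~R₂ R₂~R₁ , transfer R₂ R₁ R₂~R₁ R₁~R₂
    where
    R₂~R₁ : EquivRays G R₂ R₁
    R₂~R₁ = EquivRays-sym R₁ R₂ R₁~R₂
    transfer : ∀ R R' → EquivRays G R R' → EquivRays G R' R → sigma G R t → sigma G R' t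
    transfer R R' R~R' R'~R (∂up , ¬∂out) =
      InBoundary-resp-EquivRays R R' (up t) R~R' ∂up , ¬∂out ∘ InBoundary-resp-EquivRays R' R (notUp t) R'~R

  data AscendingPath : V → V → Set where
    edge : ∀ {a b} → E a b → a ≺ b → AscendingPath a b
    cons : ∀ {a b c} → E a b → a ≺ b → AscendingPath b c → AscendingPath a c

  AscendingPath-≺ : ∀ {a b} → AscendingPath a b → a ≺ b
  AscendingPath-≺ (edge _ a≺b)   = a≺b
  AscendingPath-≺ (cons _ a≺b p) = ≺-trans a≺b (AscendingPath-≺ p)

  AscendingPath-snoc : ∀ {a b c} → AscendingPath a b → E b c → b ≺ c → AscendingPath a c
  AscendingPath-snoc (edge e a≺b)   e' b≺c = cons e a≺b (edge e' b≺c)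
  AscendingPath-snoc (cons e a≺b p) e' b≺c = cons e a≺b (AscendingPath-snoc p e' b≺c)

  Between : V → V → V → Set
  Between a b x = a ≼ x × x ≼ b

  AscendingPath⇒walk : ∀ {a b c} → a ≼ b → AscendingPath b c → PathAvoid G (λ x → ¬ Between a c x) b c
  AscendingPath⇒walk a≼b (edge e b≺c) =
    step (λ out → out (a≼b , proj₁ b≺c)) e (here λ out → out (≼-trans a≼b (proj₁ b≺c) , ≼-refl))
  AscendingPath⇒walk a≼b (cons e b≺b' p) =
    step (λ out → out (a≼b , proj₁ (≺-trans b≺b' (AscendingPath-≺ p)))) e
         (AscendingPath⇒walk (≼-trans a≼b (proj₁ b≺b')) p)

module Classical (lem : ExcludedMiddle 0ℓ) where

  dne : {P : Set} → ¬ ¬ P → P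
  dne = em⇒dne lem

  ¬AllFrom⇒∃ : ∀ {P : ℕ → Set} {k} → ¬ AllFrom k P → ∃[ i ] (k ≤ i × ¬ P i)
  ¬AllFrom⇒∃ ¬all = dne λ ¬∃ → ¬all λ i k≤i → dne λ ¬Pi → ¬∃ (i , k≤i , ¬Pi)

  last-before-exit : ∀ {P : ℕ → Set} {j i} → j ≤′ i → P j → ¬ P i → ∃[ k ] (j ≤ k × P k × ¬ P (suc k))
  last-before-exit ≤′-refl Pj ¬Pj = ⊥-elim (¬Pj Pj)
  last-before-exit {P} (≤′-step {n = i} j≤′i) Pj ¬Pi+1 with lem {P i}
  ... | yes Pi = i , ≤′⇒≤ j≤′i , Pi , ¬Pi+1
  ... | no ¬Pi = last-before-exit j≤′i Pj ¬Pi

  module ClassicalOrderTree (𝕋 : OrderTree) where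
    open OrderTree 𝕋
    open OrderTreeProperties 𝕋

    ≺-rec : (P : V → Set) → (∀ a → (∀ b → b ≺ a → P b) → P a) → ∀ a → P a
    ≺-rec P ind a = dne λ ¬Pa → minimal-counterexample (down-least a (λ x → ¬ P x) (a , ≼-refl , ¬Pa))
      where
      minimal-counterexample : ¬ (∃[ m ] (m ≼ a × ¬ P m × (∀ b → b ≼ a → ¬ P b → m ≼ b)))
      minimal-counterexample (m , m≼a , ¬Pm , least) =
        ¬Pm (ind m λ b b≺m → dne λ ¬Pb → ≺⇒⋡ b≺m (least b (≼-trans (proj₁ b≺m) m≼a) ¬Pb))

    ≺-mono⇒inflationary : ∀ {v} (g : Σ V (_≺ v) → V) → (∀ a → g a ≺ v) →
      (∀ a b → proj₁ a ≺ proj₁ b → g a ≺ g b) → ∀ a → proj₁ a ≼ g a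
    ≺-mono⇒inflationary {v} g g≺v g-mono (a , a≺v) = ≺-rec P ind a a≺v
      where
      P : V → Set
      P x = (x≺v : x ≺ v) → x ≼ g (x , x≺v)
      ind : ∀ a → (∀ b → b ≺ a → P b) → P a
      ind a ih a≺v = dne λ a⋠ga →
        ≺⇒⋡ (g-mono (_ , q a⋠ga) (a , a≺v) (ga≺a a⋠ga)) (ih _ (ga≺a a⋠ga) (q a⋠ga))
        where
        ga≺a : ¬ (a ≼ g (a , a≺v)) → g (a , a≺v) ≺ a
        ga≺a = comparable∧⋡⇒≺ (down-total (proj₁ (g≺v (a , a≺v))) (proj₁ a≺v))
        q : ¬ (a ≼ g (a , a≺v)) → g (a , a≺v) ≺ v
        q a⋠ga = ≺-trans (ga≺a a⋠ga) a≺v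

    FiniteInterval : V → V → Set
    FiniteInterval a t = ∃[ Ys ] (∀ b → a ≼ b → b ≼ t → b ∈ Ys)

    NoMaxBelow : V → Set
    NoMaxBelow y = ∀ s → s ≺ y → ∃[ s' ] (s ≺ s' × s' ≺ y)

    finite-interval-from-limit : ∀ t → ∃[ y ] (y ≼ t × FiniteInterval y t × NoMaxBelow y)
    finite-interval-from-limit t
      with down-least t (λ a → FiniteInterval a t) (t , ≼-refl , t ∷ [] , λ b t≼b b≼t → here (≼-antisym b≼t t≼b))
    ... | y , y≼t , (Ys , Ys-covers) , least = y , y≼t , (Ys , Ys-covers) , no-max
      where
      no-max : NoMaxBelow y
      no-max s s≺y = dne λ ¬∃ → ≺⇒⋡ s≺y (least s (≼-trans (proj₁ s≺y) y≼t) (s ∷ Ys , covers ¬∃))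
        where
        covers : ¬ (∃[ s' ] (s ≺ s' × s' ≺ y)) → ∀ b → s ≼ b → b ≼ t → b ∈ s ∷ Ys
        covers ¬∃ b s≼b b≼t with lem {y ≼ b} | lem {b ≡ s}
        ... | yes y≼b | _       = there (Ys-covers b y≼b b≼t)
        ... | no _    | yes b≡s = here b≡s
        ... | no y⋠b  | no b≢s  =
          ⊥-elim (¬∃ (b , (s≼b , b≢s ∘ sym) , comparable∧⋡⇒≺ (down-total b≼t y≼t) y⋠b))

    strict-upper-bound : ∀ {H : V → Set} {h} → (∀ a b → H a → H b → (a ≼ b) ⊎ (b ≼ a)) →
      (∀ t → H t → ∃[ t' ] (H t' × t ≺ t')) → H h →
      ∀ X → ∃[ s ] (H s × ∀ x → x ∈ X → H x → x ≺ s)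
    strict-upper-bound chain no-max h∈H [] = _ , h∈H , λ _ ()
    strict-upper-bound {H} chain no-max h∈H (x ∷ X)
      with strict-upper-bound chain no-max h∈H X | lem {H x}
    ... | s , s∈H , X≺s | no x∉H =
      s , s∈H , λ { _ (here refl) x∈H → ⊥-elim (x∉H x∈H) ; x' (there x'∈X) → X≺s x' x'∈X }
    ... | s , s∈H , X≺s | yes x∈H =
      let (u , u∈H , s≼u , x≼u) = join (chain s x s∈H x∈H)
          (s' , s'∈H , u≺s')    = no-max u u∈H
      in s' , s'∈H , λ
        { _ (here refl) _ → ≼-≺-trans x≼u u≺s'
        ; x' (there x'∈X) x'∈H → ≺-trans (X≺s x' x'∈X x'∈H) (≼-≺-trans s≼u u≺s') }
      where
      join : (s ≼ x) ⊎ (x ≼ s) → ∃[ u ] (H u × s ≼ u × x ≼ u)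
      join (inj₁ s≼x) = x , x∈H , s≼x , ≼-refl
      join (inj₂ x≼s) = s , s∈H , ≼-refl , x≼s

    -- Points are paired with a proof of membership in True form, so that two
    -- points with the same vertex are equal: this gives trichotomy.
    module LimitOrdinalBelow (y : V) (y≢root : y ≢ root) (no-max : NoMaxBelow y) where
      Point : Set
      Point = Σ V λ s → True (lem {s ≺ y})

      point : ∀ s → s ≺ y → Point
      point s s≺y = s , fromWitness s≺y

      point-≺ : (p : Point) → proj₁ p ≺ y
      point-≺ p = toWitness (proj₂ p)

      _<ᵖ_ : Point → Point → Set
      p <ᵖ q = proj₁ p ≺ proj₁ q

      point-≡ : ∀ (p q : Point) → proj₁ p ≡ proj₁ q → p ≡ q
      point-≡ (s , w) (.s , w') refl = cong (s ,_) (T-irrelevant w w')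

      <ᵖ-tri : ∀ p q → (p <ᵖ q) ⊎ (p ≡ q) ⊎ (q <ᵖ p)
      <ᵖ-tri p q with lem {proj₁ p ≡ proj₁ q}
      ... | yes p≡q = inj₂ (inj₁ (point-≡ p q p≡q))
      ... | no p≢q with down-total (proj₁ (point-≺ p)) (proj₁ (point-≺ q))
      ...   | inj₁ p≼q = inj₁ (p≼q , p≢q)
      ...   | inj₂ q≼p = inj₂ (inj₂ (q≼p , p≢q ∘ sym))

      <ᵖ-wellFounded : WellFounded _<ᵖ_
      <ᵖ-wellFounded (s , w) =
        ≺-rec (λ s → ∀ w → Acc _<ᵖ_ (s , w)) (λ _ ih _ → acc λ {q} q<s → ih (proj₁ q) q<s (proj₂ q)) s w

      ordinal : LimitOrdinal
      ordinal = record
        { W        = Point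
        ; _<_      = _<ᵖ_
        ; <-irrefl = ≺-irrefl
        ; <-trans  = ≺-trans
        ; <-tri    = <ᵖ-tri
        ; <-wf     = <ᵖ-wellFounded
        ; nonzero  = point root (root-≼ y , y≢root ∘ sym)
        ; no-max   = λ p → let (s' , p≺s' , s'≺y) = no-max (proj₁ p) (point-≺ p) in point s' s'≺y , p≺s'
        }

  module ClassicalTGraph {𝕋 : OrderTree} (G : TGraph 𝕋) where
    open OrderTree 𝕋
    open TGraph G
    open OrderTreeProperties 𝕋
    open ClassicalOrderTree 𝕋
    open TGraphProperties G

    ray-eventually-avoids : (R : Ray G) (X : List V) → Eventually (λ i → r R i ∉ X)
    ray-eventually-avoids R [] = 0 , λ _ _ ()
    ray-eventually-avoids R (x ∷ X) with ray-eventually-avoids R X | lem {∃[ i ] (r R i ≡ x)}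
    ... | k , avoid | no x∉R =
      k , λ { i k≤i (here ρi≡x) → x∉R (i , ρi≡x) ; i k≤i (there ρi∈X) → avoid i k≤i ρi∈X }
    ... | k , avoid | yes (i₀ , ρi₀≡x) = k ⊔ suc i₀ , λ
      { i k⊔i₀<i (here ρi≡x) →
          <-irrefl (sym (inj R i i₀ (trans ρi≡x (sym ρi₀≡x)))) (≤-trans (m≤n⊔m k (suc i₀)) k⊔i₀<i)
      ; i k⊔i₀<i (there ρi∈X) → avoid i (≤-trans (m≤m⊔n k (suc i₀)) k⊔i₀<i) ρi∈X }

    ascending-path : ∀ {a b} → a ≺ b → AscendingPath a b
    ascending-path {a} {b} = ≺-rec (λ c → a ≺ c → AscendingPath a c) ind b
      where
      ind : ∀ c → (∀ u → u ≺ c → a ≺ u → AscendingPath a u) → a ≺ c → AscendingPath a c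
      ind c ih a≺c with E-cofinal c a a≺c
      ... | u , a≼u , u≺c , e with lem {a ≡ u}
      ...   | yes refl = edge e u≺c
      ...   | no a≢u   = AscendingPath-snoc (ih u u≺c (a≼u , a≢u)) e u≺c

    interval-walk : ∀ {a b} → a ≼ b → PathAvoid G (λ x → ¬ Between a b x) a b
    interval-walk {a} {b} a≼b with lem {a ≡ b}
    ... | yes refl = here λ out → out (≼-refl , ≼-refl)
    ... | no a≢b   = AscendingPath⇒walk ≼-refl (ascending-path (a≼b , a≢b))

    walk-within-chain : ∀ {H : V → Set} {X s} → (∀ a b → H b → a ≼ b → H a) →
      (∀ a b → H a → H b → (a ≼ b) ⊎ (b ≼ a)) → (∀ x → x ∈ X → H x → x ≺ s) →
      ∀ {a b} → H a → H b → s ≺ a → s ≺ b → PathAvoid G (InList G X) a b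
    walk-within-chain {H} {X} {s} down-closed chain X≺s {a} {b} a∈H b∈H s≺a s≺b = connect (chain a b a∈H b∈H)
      where
      outside : ∀ {c d} → H d → s ≺ c → ∀ x → ¬ ¬ Between c d x → x ∉ X
      outside d∈H s≺c x in-cd x∈X = in-cd λ (c≼x , x≼d) →
        ≺-irrefl (≺-≼-trans (X≺s x x∈X (down-closed x _ d∈H x≼d)) (≼-trans (proj₁ s≺c) c≼x))
      connect : (a ≼ b) ⊎ (b ≼ a) → PathAvoid G (InList G X) a b
      connect (inj₁ a≼b) = walk-map (outside b∈H s≺a) (interval-walk a≼b)
      connect (inj₂ b≼a) = walk-reverse (walk-map (outside a∈H s≺b) (interval-walk b≼a))

    EventuallyBelow : Ray G → V → Set
    EventuallyBelow R t = Eventually (λ i → t ≼ r R i)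

    module _ (R : Ray G) where
      private
        ρ : ℕ → V
        ρ = r R

      TailLowerBound : ℕ → V → Set
      TailLowerBound n t = AllFrom n (λ i → t ≼ ρ i)

      EventuallyBelow-down-closed : ∀ a b → EventuallyBelow R b → a ≼ b → EventuallyBelow R a
      EventuallyBelow-down-closed a b (n , b≼ρ) a≼b = n , λ i n≤i → ≼-trans a≼b (b≼ρ i n≤i)

      EventuallyBelow-chain : ∀ a b → EventuallyBelow R a → EventuallyBelow R b → (a ≼ b) ⊎ (b ≼ a)
      EventuallyBelow-chain a b (m , a≼ρ) (n , b≼ρ) = down-total (a≼ρ (m ⊔ n) (m≤m⊔n m n)) (b≼ρ (m ⊔ n) (m≤n⊔m m n))

      EventuallyBelow⇒eventually-≺ : ∀ t → EventuallyBelow R t → Eventually (λ i → t ≺ ρ i)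
      EventuallyBelow⇒eventually-≺ t (n , t≼ρ) with ray-eventually-avoids R (t ∷ [])
      ... | k , ρ≢t = n ⊔ k , λ i n⊔k≤i →
        t≼ρ i (≤-trans (m≤m⊔n n k) n⊔k≤i) , λ t≡ρi → ρ≢t i (≤-trans (m≤n⊔m n k) n⊔k≤i) (here (sym t≡ρi))

      -- c is the successor of t towards ρ p; the ray cannot step below c
      -- without stepping below t.
      EventuallyBelow-no-max : ∀ t → EventuallyBelow R t → ∃[ t' ] (EventuallyBelow R t' × t ≺ t')
      EventuallyBelow-no-max t t∈B with EventuallyBelow⇒eventually-≺ t t∈B
      ... | p , t≺ρ with down-least (ρ p) (t ≺_) (ρ p , ≼-refl , t≺ρ p ≤-refl)
      ...   | c , c≼ρp , t≺c , least = c , (p , c≼ρ) , t≺c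
        where
        c≼ρ : TailLowerBound p c
        c≼ρ = AllFrom-induction c≼ρp λ i p≤i c≼ρi → dne λ c⋠ρi+1 →
          let ρi+1≺c = step-out-of-up⇒≺ R c≼ρi c⋠ρi+1 in
          ≺⇒⋡ ρi+1≺c (least _ (≼-trans (proj₁ ρi+1≺c) c≼ρp) (t≺ρ (suc i) (m≤n⇒m≤1+n p≤i)))

      tail-infimum : ∀ n → ∃[ j ] (n ≤ j × TailLowerBound n (ρ j) × (∀ a → TailLowerBound n a → a ≼ ρ j))
      tail-infimum n with lem {∃[ y ] (y ≼ ρ n × ¬ TailLowerBound n y)}
      ... | no ¬∃ = n , ≤-refl , dne (λ ¬lb → ¬∃ (ρ n , ≼-refl , ¬lb)) , λ a a-lb → a-lb n ≤-refl
      ... | yes ∃y with down-least (ρ n) (λ y → ¬ TailLowerBound n y) ∃y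
      ... | y , y≼ρn , ¬lb-y , least with ¬AllFrom⇒∃ ¬lb-y
      ... | i , n≤i , y⋠ρi with last-before-exit (≤⇒≤′ n≤i) y≼ρn y⋠ρi
      ... | j , n≤j , y≼ρj , y⋠ρj+1 =
        suc j , m≤n⇒m≤1+n n≤j , ρj+1-lb , λ a a-lb → a-lb (suc j) (m≤n⇒m≤1+n n≤j)
        where
        ρj+1≺y : ρ (suc j) ≺ y
        ρj+1≺y = step-out-of-up⇒≺ R y≼ρj y⋠ρj+1
        ρj+1-lb : TailLowerBound n (ρ (suc j))
        ρj+1-lb = dne λ ¬lb → ≺⇒⋡ ρj+1≺y (least _ (≼-trans (proj₁ ρj+1≺y) y≼ρn) ¬lb)

      infimum-index : ℕ → ℕ
      infimum-index n = proj₁ (tail-infimum n)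

      infimum : ℕ → V
      infimum n = ρ (infimum-index n)

      infimum-index-≥ : ∀ n → n ≤ infimum-index n
      infimum-index-≥ n = proj₁ (proj₂ (tail-infimum n))

      infimum-lower : ∀ n → TailLowerBound n (infimum n)
      infimum-lower n = proj₁ (proj₂ (proj₂ (tail-infimum n)))

      infimum-greatest : ∀ n t → TailLowerBound n t → t ≼ infimum n
      infimum-greatest n = proj₂ (proj₂ (proj₂ (tail-infimum n)))

      infimum-mono : ∀ {i j} → i ≤ j → infimum i ≼ infimum j
      infimum-mono i≤j = infimum-greatest _ _ (AllFrom-mono i≤j (infimum-lower _))

      EventuallyBelow-isHighRay : IsHighRay 𝕋 (EventuallyBelow R)
      EventuallyBelow-isHighRay =
        isHighRay EventuallyBelow-down-closed EventuallyBelow-chain EventuallyBelow-no-max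
          infimum infimum-mono
          (λ n → n , infimum-lower n) (λ t (n , t-lb) → n , infimum-greatest n t t-lb)

      EventuallyBelow-ray-vertex-above : ∀ s → EventuallyBelow R s → ∀ K →
        ∃[ j ] (K ≤ j × EventuallyBelow R (ρ j) × s ≺ ρ j)
      EventuallyBelow-ray-vertex-above s s∈B K with EventuallyBelow-no-max s s∈B
      ... | s' , (n , s'≼ρ) , s≺s' =
        infimum-index (n ⊔ K) , ≤-trans (m≤n⊔m n K) (infimum-index-≥ (n ⊔ K)) ,
        (n ⊔ K , infimum-lower (n ⊔ K)) ,
        ≺-≼-trans s≺s' (infimum-greatest (n ⊔ K) s' (AllFrom-mono (m≤m⊔n n K) s'≼ρ))

    module _ (y : V) (y≢root : y ≢ root) (no-max : NoMaxBelow y) where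
      open LimitOrdinalBelow y y≢root no-max

      ≺⇒HeightLe : ∀ u → u ≺ y → HeightLe G ordinal u
      ≺⇒HeightLe u u≺y = (λ a → point (proj₁ a) (≺-trans (proj₂ a) u≺y)) , λ _ _ a≺b → a≺b

      ≻⇒¬HeightLe : ∀ v → y ≺ v → ¬ HeightLe G ordinal v
      ≻⇒¬HeightLe v y≺v (F , F-mono) = ≺⇒⋡ (F-mono x (y , y≺v) x≺y) (≺-mono⇒inflationary g g≺v F-mono x)
        where
        g : Σ V (_≺ v) → V
        g = proj₁ ∘ F
        g≺v : ∀ a → g a ≺ v
        g≺v a = ≺-trans (point-≺ (F a)) y≺v
        x : Σ V (_≺ v)
        x = g (y , y≺v) , g≺v (y , y≺v)
        x≺y : proj₁ x ≺ y
        x≺y = point-≺ (F (y , y≺v))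

    ReachableAbove : V → V → V → Set
    ReachableAbove y = PathAvoid G (λ x → ¬ (y ≺ x))

    finite-adhesion-below : FiniteAdhesion G → ∀ y → NoMaxBelow y → ∀ v → y ≺ v →
      ∃[ L ] (∀ u w → u ≺ y → ReachableAbove y v w → E w u → u ∈ L)
    finite-adhesion-below adhesion y no-max v y≺v with lem {y ≡ root}
    ... | yes refl = [] , λ u _ u≺root → ⊥-elim (≺⇒⋡ u≺root (root-≼ u))
    ... | no y≢root
      with adhesion (LimitOrdinalBelow.ordinal y y≢root no-max) v (≻⇒¬HeightLe y y≢root no-max v y≺v)
    ... | L , L-covers = L , λ u w u≺y v⇝w e →
      L-covers u (≺⇒HeightLe y y≢root no-max u u≺y)
        (w , walk-map (λ x ¬¬y≺x → ≻⇒¬HeightLe y y≢root no-max x (dne ¬¬y≺x)) v⇝w , e)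

    -- Crossing from above t to below t would need an edge to a vertex of
    -- [y,t] ⊆ Ys, or to a vertex below y adjacent to the component, i.e. in L.
    walk-stays-above : ∀ {y t v Ys L} → y ≼ t → (∀ b → y ≼ b → b ≼ t → b ∈ Ys) →
      (∀ u w → u ≺ y → ReachableAbove y v w → E w u → u ∈ L) →
      ∀ {a w} → PathAvoid G (InList G (L ++ Ys)) a w → t ≺ a → ReachableAbove y v a → t ≼ w
    walk-stays-above y≼t Ys-covers L-covers (here _) t≺a _ = proj₁ t≺a
    walk-stays-above {y} {t} {Ys = Ys} {L} y≼t Ys-covers L-covers {a} {w} (step {b = b} _ e p) t≺a v⇝a =
      continue (lem {t ≼ b})
      where
      b-blocked : b ∉ L ++ Ys
      b-blocked = walk-start p
      below-t : ¬ (t ≼ b) → b ≺ t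
      below-t t⋠b with E-comparable e
      ... | inj₁ a≼b = ⊥-elim (t⋠b (≼-trans (proj₁ t≺a) a≼b))
      ... | inj₂ b≼a = comparable∧⋡⇒≺ (down-total b≼a (proj₁ t≺a)) t⋠b
      blocked-below-t : b ≺ t → b ∈ L ++ Ys
      blocked-below-t b≺t with lem {y ≼ b}
      ... | yes y≼b = ∈-++⁺ʳ L (Ys-covers b y≼b (proj₁ b≺t))
      ... | no y⋠b  = ∈-++⁺ˡ (L-covers b a (comparable∧⋡⇒≺ (down-total (proj₁ b≺t) y≼t) y⋠b) v⇝a e)
      continue : Dec (t ≼ b) → t ≼ w
      continue (yes t≼b) = walk-stays-above y≼t Ys-covers L-covers p t≺b
                             (walk-snoc v⇝a e λ ¬y≺b → ¬y≺b (≼-≺-trans y≼t t≺b))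
        where
        t≺b : t ≺ b
        t≺b = t≼b , λ { refl → b-blocked (∈-++⁺ʳ L (Ys-covers t y≼t ≼-refl)) }
      continue (no t⋠b) = ⊥-elim (b-blocked (blocked-below-t (below-t t⋠b)))

    sigma⇒EventuallyBelow : ∀ R t → sigma G R t → EventuallyBelow R t
    sigma⇒EventuallyBelow R t (_ , ¬∂out) = dne λ t∉B → ¬∂out λ X →
      let (k , avoid) = ray-eventually-avoids R X
          (i , k≤i , t⋠ρi) = ¬AllFrom⇒∃ (λ t-lb → t∉B (k , t-lb))
      in k , avoid , r R i , t⋠ρi , ray-walk R k≤i avoid

    EventuallyBelow⇒∂up : ∀ R t → EventuallyBelow R t → InBoundary G R (up t)
    EventuallyBelow⇒∂up R t (n , t≼ρ) X =
      let (k , avoid) = ray-eventually-avoids R X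
      in k ⊔ n , AllFrom-mono (m≤m⊔n k n) avoid , r R (k ⊔ n) , t≼ρ _ (m≤n⊔m k n) , here (avoid _ (m≤m⊔n k n))

    EventuallyBelow⇒¬∂out : FiniteAdhesion G → ∀ R t → EventuallyBelow R t → ¬ InBoundary G R (notUp t)
    EventuallyBelow⇒¬∂out adhesion R t t∈B ∂out
      with EventuallyBelow⇒eventually-≺ R t t∈B | finite-interval-from-limit t
    ... | n , t≺ρ | y , y≼t , (Ys , Ys-covers) , no-max
      with finite-adhesion-below adhesion y no-max (r R n) (≼-≺-trans y≼t (t≺ρ n ≤-refl))
    ... | L , L-covers with ∂out (L ++ Ys)
    ... | k , avoid , w , t⋠w , ρk⇝w =
      t⋠w (walk-stays-above y≼t Ys-covers L-covers
             (walk-reverse (ray-walk R (m≤m⊔n k n) avoid) ++ʷ ρk⇝w)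
             (t≺ρ _ (m≤n⊔m k n))
             (ray-walk R (m≤n⊔m k n) λ i n≤i ¬y≺ρi → ¬y≺ρi (≼-≺-trans y≼t (t≺ρ i n≤i))))

    sigma≐EventuallyBelow : FiniteAdhesion G → ∀ R → sigma G R ≐ EventuallyBelow R
    sigma≐EventuallyBelow adhesion R t =
      sigma⇒EventuallyBelow R t , λ t∈B → EventuallyBelow⇒∂up R t t∈B , EventuallyBelow⇒¬∂out adhesion R t t∈B

    EventuallyBelow≐⇒EquivRays : ∀ R₁ R₂ → EventuallyBelow R₁ ≐ EventuallyBelow R₂ → EquivRays G R₁ R₂
    EventuallyBelow≐⇒EquivRays R₁ R₂ B₁≐B₂ X
      with strict-upper-bound (EventuallyBelow-chain R₁) (EventuallyBelow-no-max R₁)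
             (0 , λ i _ → root-≼ (r R₁ i)) X
    ... | s , s∈B₁ , X≺s
      with ray-eventually-avoids R₁ X | ray-eventually-avoids R₂ X
    ... | k₁ , avoid₁ | k₂ , avoid₂
      with EventuallyBelow-ray-vertex-above R₁ s s∈B₁ k₁
         | EventuallyBelow-ray-vertex-above R₂ s (proj₁ (B₁≐B₂ s) s∈B₁) k₂
    ... | i , k₁≤i , ρi∈B₁ , s≺ρi | j , k₂≤j , ρ'j∈B₂ , s≺ρ'j =
      i , j , AllFrom-mono k₁≤i avoid₁ , AllFrom-mono k₂≤j avoid₂ ,
      walk-within-chain (EventuallyBelow-down-closed R₁) (EventuallyBelow-chain R₁) X≺s
        ρi∈B₁ (proj₂ (B₁≐B₂ _) ρ'j∈B₂) s≺ρi s≺ρ'j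

    module RayAlong (H : V → Set) (down-closed : ∀ a b → H b → a ≼ b → H a)
                    (f : ℕ → V) (f∈H : ∀ n → H (f n)) (f-strict : ∀ n → f n ≺ f (suc n))
                    (f-cofinal : ∀ h → H h → ∃[ n ] (h ≼ f n)) where

      -- The ray runs along an ascending path from f n to f (suc n), for n = 0, 1, 2, …
      State : Set
      State = Σ ℕ λ n → Σ V λ c → AscendingPath c (f (suc n))

      segment-start : ℕ → State
      segment-start n = n , f n , ascending-path (f-strict n)

      next : State → State
      next (n , _ , edge _ _)         = segment-start (suc n)
      next (n , _ , cons {b = c} _ _ p) = n , c , p

      state : ℕ → State
      state zero    = segment-start 0
      state (suc k) = next (state k)

      position : State → V
      position (_ , c , _) = c

      g : ℕ → V
      g = position ∘ state

      next-edge : ∀ s → E (position s) (position (next s))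
      next-edge (_ , _ , edge e _)   = e
      next-edge (_ , _ , cons e _ _) = e

      next-≺ : ∀ s → position s ≺ position (next s)
      next-≺ (_ , _ , edge _ c≺d)   = c≺d
      next-≺ (_ , _ , cons _ c≺d _) = c≺d

      ray : Ray G
      ray = record { r = g ; inj = increasing-steps⇒injective g (next-≺ ∘ state) ; adj = next-edge ∘ state }

      position∈H : ∀ s → H (position s)
      position∈H (n , c , p) = down-closed c (f (suc n)) (f∈H (suc n)) (proj₁ (AscendingPath-≺ p))

      next-segment-reached : ∀ k n c (p : AscendingPath c (f (suc n))) → state k ≡ (n , c , p) →
        ∃[ k' ] (state k' ≡ segment-start (suc n))
      next-segment-reached k n c (edge _ _)   reached = suc k , cong next reached
      next-segment-reached k n c (cons _ _ p) reached = next-segment-reached (suc k) n _ p (cong next reached)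

      segment-reached : ∀ n → ∃[ k ] (state k ≡ segment-start n)
      segment-reached zero = 0 , refl
      segment-reached (suc n) with segment-reached n
      ... | k , reached = next-segment-reached k n (f n) (ascending-path (f-strict n)) reached

      f-below-tail : ∀ n → EventuallyBelow ray (f n)
      f-below-tail n with segment-reached n
      ... | k , reached = k , λ i k≤i →
        subst (_≼ g i) (cong position reached) (increasing-steps⇒monotone g (next-≺ ∘ state) k≤i)

      EventuallyBelow≐H : EventuallyBelow ray ≐ H
      EventuallyBelow≐H t =
        (λ (n , t≼g) → down-closed t (g n) (position∈H (state n)) (t≼g n ≤-refl)) ,
        (λ t∈H → let (n , t≼fn) = f-cofinal t t∈H
                 in EventuallyBelow-down-closed ray t (f n) (f-below-tail n) t≼fn)

lemma5p1 : ExcludedMiddle 0ℓ →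
    (𝕋 : OrderTree) (G : TGraph 𝕋) → FiniteAdhesion G →
    ((R : Ray G) → IsHighRay 𝕋 (sigma G R)) ×
    ((R₁ R₂ : Ray G) → EquivRays G R₁ R₂ → sigma G R₁ ≐ sigma G R₂) ×
    ((R₁ R₂ : Ray G) → sigma G R₁ ≐ sigma G R₂ → EquivRays G R₁ R₂) ×
    ((H : OrderTree.V 𝕋 → Set) → IsHighRay 𝕋 H → ∃[ R ] (sigma G R ≐ H))
lemma5p1 lem 𝕋 G adhesion =
  (λ R → IsHighRay-resp-≐ (≐-sym (sigma≐EventuallyBelow adhesion R)) (EventuallyBelow-isHighRay R)) ,
  sigma-resp-EquivRays ,
  (λ R₁ R₂ σ₁≐σ₂ → EventuallyBelow≐⇒EquivRays R₁ R₂
     (≐-trans (≐-sym (sigma≐EventuallyBelow adhesion R₁)) (≐-trans σ₁≐σ₂ (sigma≐EventuallyBelow adhesion R₂)))) ,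
  λ { H (down-closed , _ , f , f∈H , f-strict , f-cofinal) →
      let open RayAlong H down-closed f f∈H f-strict f-cofinal
      in ray , ≐-trans (sigma≐EventuallyBelow adhesion ray) EventuallyBelow≐H }
  where
  open OrderTreeProperties 𝕋
  open TGraphProperties G
  open Classical lem
  open ClassicalTGraph G
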